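{- For every group $\alpha$, the formula $[\alpha]p\rightarrow\neg\neg\langle\alpha\rangle p$ is valid in every epistemic frame. Here a frame $(W,\leq,R)$ is epistemic if it satisfies both: - it is doxastic, i.e., for all groups $\beta$ and all $s,t$, $sR(\beta)t$ implies $s\leq t$; - for every group $\beta$ and every $s\in W$ there is $t\in W$ with $s\,(\leq\circ R(\beta))\,t$.
   Context: **Language.** Let $\mathbf{At}$ be a countably infinite set of atoms and let $\mathbf{Ag}$ be a finite set of agents. A group is a nonempty subset of $\mathbf{Ag}$. Formulas are generated by $$A ::= p \mid (A\rightarrow A) \mid \top \mid \bot \mid (A\vee A) \mid (A\wedge A) \mid [\alpha]A \mid \langle\alpha\rangle A,$$ and $\neg A$ abbreviates $A\rightarrow\bot$. **Frames.** A frame is a triple $(W,\leq,R)$ where $W$ is a nonempty set, $\leq$ is a preorder on $W$, and $R$ assigns to each group $\alpha$ a binary relation $R(\alpha)$ on $W$. For binary relations $S,T$, write $s\,(S\circ T)\,t$ iff there is $u$ with $sSu$ and $uTt$. Write $\geq$ for the converse of $\leq$. **Models and satisfaction.** A valuation is a map $V:\mathbf{At}\to\wp(W)$ with each $V(p)$ upward closed under $\leq$. Satisfaction in a model $(W,\leq,R,V)$ is defined as follows: - $s\models p$ iff $s\in V(p)$; - $s\models A\rightarrow B$ iff for all $t\geq s$, either $t\not\models A$ or $t\models B$; - $s\models\top$, and $s\not\models\bot$; - $\vee$ and $\wedge$ are interpreted pointwise; - $s\models[\alpha]A$ iff for all $t$ with $s\,(\leq\circ R(\alpha))\,t$, $t\models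 A$; - $s\models\langle\alpha\rangle A$ iff there is $t$ with $s\,(\geq\circ R(\alpha))\,t$ and $t\models A$. A formula is valid in a frame if it is satisfied at every state of every model based on that frame. -}

module Defs where

open import Data.Nat using (ℕ)
open import Data.Fin using (Fin)
open import Data.Fin.Subset using (Subset; Nonempty)
open import Data.Product using (Σ; ∃; _×_; _,_)
open import Data.Sum using (_⊎_)
open import Data.Empty using (⊥)
open import Data.Unit using (⊤)
open import Relation.Nullary using (¬_)

Atom : Set
Atom = ℕ

Group : ℕ → Set
Group n = Σ (Subset n) Nonempty

data Form (n : ℕ) : Set where
  atom : Atom → Form n
  _⇒_  : Form n → Form n → Form n
  ⊤ᶠ   : Form n
  ⊥ᶠ   : Form n
  _∨ᶠ_ : Form n → Form n → Form n
  _∧ᶠ_ : Form n → Form n → Form n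
  box  : Group n → Form n → Form n
  dia  : Group n → Form n → Form n

negᶠ : ∀ {n} → Form n → Form n
negᶠ A = A ⇒ ⊥ᶠ

record Frame (n : ℕ) : Set₁ where
  field
    W        : Set
    inhabited : W
    _≤_      : W → W → Set
    ≤-refl   : ∀ {s} → s ≤ s
    ≤-trans  : ∀ {s t u} → s ≤ t → t ≤ u → s ≤ u
    R        : Group n → W → W → Set

record Valuation {n : ℕ} (F : Frame n) : Set₁ where
  open Frame F
  field
    V      : Atom → W → Set
    upward : ∀ p {s t} → s ≤ t → V p s → V p t

module _ {n : ℕ} (F : Frame n) (Val : Valuation F) where
  open Frame F
  open Valuation Val

  _⊨_ : W → Form n → Set
  s ⊨ atom p  = V p s
  s ⊨ (A ⇒ B) = ∀ t → s ≤ t → t ⊨ A → t ⊨ B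
  s ⊨ ⊤ᶠ      = ⊤
  s ⊨ ⊥ᶠ      = ⊥
  s ⊨ (A ∨ᶠ B) = (s ⊨ A) ⊎ (s ⊨ B)
  s ⊨ (A ∧ᶠ B) = (s ⊨ A) × (s ⊨ B)
  -- s (≤ ∘ R α) t  iff  ∃ u. s ≤ u × u R α t
  s ⊨ box α A = ∀ t → (∃ λ u → s ≤ u × R α u t) → t ⊨ A
  -- s (≥ ∘ R α) t  iff  ∃ u. u ≤ s × u R α t
  s ⊨ dia α A = ∃ λ t → (∃ λ u → u ≤ s × R α u t) × (t ⊨ A)

ValidIn : ∀ {n} → Frame n → Form n → Set₁
ValidIn F A = ∀ (Val : Valuation F) (s : Frame.W F) → _⊨_ F Val s A

Doxastic : ∀ {n} → Frame n → Set
Doxastic F = ∀ (β : Group _) s t → R β s t → s ≤ t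
  where open Frame F

Epistemic : ∀ {n} → Frame n → Set
Epistemic F = Doxastic F ×
  (∀ (β : Group _) (s : W) → ∃ λ t → ∃ λ u → s ≤ u × R β u t)
  where open Frame F

{-# OPTIONS --safe #-}
-- Above
-- any state forcing [α]A seriality yields u ≤-above it with u R α t; then t
-- forces A, so u itself forces ⟨α⟩A.  Thus ⟨α⟩A holds above every extension of
-- the state, which is exactly what ¬¬⟨α⟩A means in the Kripke semantics.
module Submission where

open import Defs
open import Data.Nat using (ℕ)
open import Data.Product using (∃; _×_; _,_; proj₂)

Serial : ∀ {n} → Frame n → Group n → Set
Serial F α = ∀ s → ∃ λ t → ∃ λ u → s ≤ u × R α u t
  where open Frame F

module _ {n : ℕ} (F : Frame n) (Val : Valuation F) where
  open Frame F

  private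
    _⊩_ : W → Form n → Set
    _⊩_ = _⊨_ F Val

  box-upward : ∀ {α A s s′} → s ≤ s′ → s ⊩ box α A → s′ ⊩ box α A
  box-upward s≤s′ □A t (u , s′≤u , uRt) = □A t (u , ≤-trans s≤s′ s′≤u , uRt)

  box⇒dia-above : ∀ {α A} → Serial F α →
                  ∀ s → s ⊩ box α A → ∃ λ u → s ≤ u × u ⊩ dia α A
  box⇒dia-above serial s □A with serial s
  ... | t , u , s≤u , uRt = u , s≤u , (t , (u , ≤-refl , uRt) , □A t (u , s≤u , uRt))

  cofinal⇒¬¬ : ∀ {A s} → (∀ t → s ≤ t → ∃ λ u → t ≤ u × u ⊩ A) → s ⊩ negᶠ (negᶠ A)
  cofinal⇒¬¬ cofinal t s≤t ¬A with cofinal t s≤t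
  ... | u , t≤u , uA = ¬A u t≤u uA

  box⇒¬¬dia : ∀ {α A} → Serial F α → ∀ s → s ⊩ (box α A ⇒ negᶠ (negᶠ (dia α A)))
  box⇒¬¬dia {α} {A} serial _ s′ _ □A = cofinal⇒¬¬ {A = dia α A} dia-above
    where
      dia-above : ∀ t → s′ ≤ t → ∃ λ u → t ≤ u × u ⊩ dia α A
      dia-above t s′≤t = box⇒dia-above {A = A} serial t (box-upward {A = A} s′≤t □A)

proposition5 : ∀ (n : ℕ) (F : Frame n) → Epistemic F → ∀ (α : Group n) (p : Atom) →
    ValidIn F (box α (atom p) ⇒ negᶠ (negᶠ (dia α (atom p))))
proposition5 n F epistemic α p Val = box⇒¬¬dia F Val (proj₂ epistemic α)
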